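{- ${\sf SCAC}\equiv_{sc}\mathsf{SCAC^{small}}$, i.e. ${\sf SCAC}\le_{sc}\mathsf{SCAC^{small}}$ and $\mathsf{SCAC^{small}}\le_{sc}{\sf SCAC}$.
   Context: A poset $(P,\le_P)$ consists of $P\subseteq\omega$ and a reflexive, antisymmetric, transitive relation $\le_P$; chains (antichains) are sets of pairwise comparable (incomparable) elements. In an infinite poset, $x$ is small if $x\le_P y$ for all but finitely many $y\in P$, large if $y\le_P x$ for all but finitely many $y$, isolated if $x$ is incomparable with all but finitely many $y$. A poset is stable if every element is small or isolated (small type) or every element is large or isolated (large type). ${\sf SCAC}$ is the problem whose instances are infinite stable posets with $P\subseteq\omega$ and whose solutions are infinite chains or infinite antichains of the instance; $\mathsf{SCAC^{small}}$ is its restriction to instances of the small type. $\mathsf P\le_{sc}\mathsf Q$ means: for every $\mathsf P$-instance $X$ there is a $\mathsf Q$-instance $\hat X\le_T X$ such that for every solution $\hat Y$ of $\hat X$ there is a solution $Y$ of $X$ with $Y\le_T\hat Y$. -}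

module Defs where

open import Data.Nat using (ℕ; zero; suc; _≤_)
open import Data.Fin using (Fin)
open import Data.Vec using (Vec; []; _∷_; lookup)
open import Data.Bool using (Bool; true; false; if_then_else_)
open import Data.Product using (Σ; ∃; _×_; _,_; proj₁; proj₂)
open import Data.Sum using (_⊎_)
open import Relation.Nullary using (¬_)
open import Relation.Binary.PropositionalEquality using (_≡_; _≢_)

-- Subsets of ω are represented by characteristic functions.

Oracle : Set
Oracle = ℕ → Bool

-- Oracle computability: partial μ-recursive functions relative to an
-- oracle O : ℕ → Bool (queries return 1 / 0).

data Code : ℕ → Set where
  czero : ∀ {n} → Code n
  csucc : Code 1
  cproj : ∀ {n} → Fin n → Code n
  corac : Code 1
  ccomp : ∀ {m n} → Code m → Vec (Code n) m → Code n
  cprec : ∀ {n} → Code n → Code (suc (suc n)) → Code (suc n)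
  cmu   : ∀ {n} → Code (suc n) → Code n

b2n : Bool → ℕ
b2n true  = 1
b2n false = 0

mutual
  data Eval (O : Oracle) : ∀ {n} → Code n → Vec ℕ n → ℕ → Set where
    ev-zero : ∀ {n} {xs : Vec ℕ n} → Eval O czero xs 0
    ev-succ : ∀ {x} → Eval O csucc (x ∷ []) (suc x)
    ev-proj : ∀ {n} {i : Fin n} {xs} → Eval O (cproj i) xs (lookup xs i)
    ev-orac : ∀ {x} → Eval O corac (x ∷ []) (b2n (O x))
    ev-comp : ∀ {m n} {f : Code m} {gs : Vec (Code n) m} {xs ys v} →
              EvalAll O xs gs ys → Eval O f ys v → Eval O (ccomp f gs) xs v
    ev-prec0 : ∀ {n} {f : Code n} {g} {xs v} →
               Eval O f xs v → Eval O (cprec f g) (0 ∷ xs) v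
    ev-precS : ∀ {n} {f : Code n} {g} {k xs u v} →
               Eval O (cprec f g) (k ∷ xs) u → Eval O g (k ∷ u ∷ xs) v →
               Eval O (cprec f g) (suc k ∷ xs) v
    ev-mu : ∀ {n} {f : Code (suc n)} {xs k} →
            Eval O f (k ∷ xs) 0 →
            (∀ i → suc i ≤ k → Σ ℕ λ w → Eval O f (i ∷ xs) (suc w)) →
            Eval O (cmu f) xs k

  data EvalAll (O : Oracle) {n : ℕ} (xs : Vec ℕ n) :
       ∀ {m} → Vec (Code n) m → Vec ℕ m → Set where
    ea-[] : EvalAll O xs [] []
    ea-∷  : ∀ {m} {g} {gs : Vec (Code n) m} {y ys} →
            Eval O g xs y → EvalAll O xs gs ys → EvalAll O xs (g ∷ gs) (y ∷ ys)

_≤T_ : Oracle → Oracle → Set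
A ≤T B = Σ (Code 1) λ e → ∀ n → Eval B e (n ∷ []) (b2n (A n))

-- Cantor unpairing ℕ → ℕ × ℕ (a bijection), used to code binary
-- relations as subsets of ω.

unpair : ℕ → ℕ × ℕ
unpair zero = 0 , 0
unpair (suc n) with unpair n
... | a , zero  = 0 , suc a
... | a , suc b = suc a , b

record Problem : Set₁ where
  field
    Inst : Set
    enc  : Inst → Oracle
    Sol  : Inst → Oracle → Set

open Problem

_≤sc_ : Problem → Problem → Set
P ≤sc Q = (X : Inst P) → Σ (Inst Q) λ X̂ →
            (enc Q X̂ ≤T enc P X) ×
            (∀ Ŷ → Sol Q X̂ Ŷ → Σ Oracle λ Y → Sol P X Y × (Y ≤T Ŷ))

-- Posets on subsets of ω.  A poset (P, ≤_P) is given by the relation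
-- le : ℕ → ℕ → Bool; P = {x | x ≤_P x} (reflexivity), and le only
-- relates elements of P.

Rel : Set
Rel = ℕ → ℕ → Bool

module _ (le : Rel) where
  InP : ℕ → Set
  InP x = le x x ≡ true

  LE : ℕ → ℕ → Set
  LE x y = le x y ≡ true

  IsPoset : Set
  IsPoset = (∀ x y → LE x y → InP x × InP y)
          × (∀ x y → LE x y → LE y x → x ≡ y)
          × (∀ x y z → LE x y → LE y z → LE x z)

  InfiniteP : Set
  InfiniteP = ∀ n → Σ ℕ λ m → n ≤ m × InP m

  AlmostAll : (ℕ → Set) → Set
  AlmostAll Q = Σ ℕ λ N → ∀ y → N ≤ y → InP y → Q y

  Small Large Isolated : ℕ → Set
  Small x    = AlmostAll (λ y → LE x y)
  Large x    = AlmostAll (λ y → LE y x)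
  Isolated x = AlmostAll (λ y → ¬ LE x y × ¬ LE y x)

  StableSmall StableLarge Stable : Set
  StableSmall = ∀ x → InP x → Small x ⊎ Isolated x
  StableLarge = ∀ x → InP x → Large x ⊎ Isolated x
  Stable = StableSmall ⊎ StableLarge

  IsChain IsAntichain InfiniteSet SubsetP : Oracle → Set
  SubsetP Y = ∀ x → Y x ≡ true → InP x
  InfiniteSet Y = ∀ n → Σ ℕ λ m → n ≤ m × Y m ≡ true
  IsChain Y = ∀ x y → Y x ≡ true → Y y ≡ true → LE x y ⊎ LE y x
  IsAntichain Y = ∀ x y → Y x ≡ true → Y y ≡ true → x ≢ y →
                  ¬ LE x y × ¬ LE y x

  SCACSol : Oracle → Set
  SCACSol Y = SubsetP Y × InfiniteSet Y × (IsChain Y ⊎ IsAntichain Y)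

encRel : Rel → Oracle
encRel le n = le (proj₁ (unpair n)) (proj₂ (unpair n))

SCAC : Problem
SCAC = record
  { Inst = Σ Rel λ le → IsPoset le × InfiniteP le × Stable le
  ; enc  = λ X → encRel (proj₁ X)
  ; Sol  = λ X → SCACSol (proj₁ X) }

SCACsmall : Problem
SCACsmall = record
  { Inst = Σ Rel λ le → IsPoset le × InfiniteP le × StableSmall le
  ; enc  = λ X → encRel (proj₁ X)
  ; Sol  = λ X → SCACSol (proj₁ X) }

-- Reversing the order of a stable poset of the large type gives a stable
-- poset of the small type with the same chains and antichains, so every
-- SCAC instance is answered by an instance of SCAC^small and the solutions
-- are passed back unchanged.  The reversed relation is Turing below the
-- original: its code is the original's composed with the total computable
-- map n ↦ pair b a, where unpair n = (a , b).  Conversely an instance of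
-- SCAC^small already is an SCAC instance.
module Submission where

open import Data.Fin using (Fin; zero; suc)
open import Data.Nat using (ℕ; zero; suc; _+_; _∸_; pred)
open import Data.Nat.Properties
  using (+-comm; 0∸n≡0; +-suc; +-identityʳ; m+n∸m≡n; [m+n]∸[m+o]≡n∸o; pred[m∸n]≡m∸[1+n])
open import Data.Product using (_×_; _,_; proj₁; proj₂; uncurry; swap)
open import Data.Sum using (inj₁; inj₂)
import Data.Sum as Sum
open import Data.Vec using (Vec; []; _∷_; lookup)
open import Function using (flip)
open import Relation.Binary.PropositionalEquality
open ≡-Reasoning
open import Defs

private
  variable
    n m : ℕ
    f g h : Vec ℕ n → ℕ

record Computable (f : Vec ℕ n → ℕ) : Set where
  field
    code    : Code n
    correct : ∀ {O} xs → Eval O code xs (f xs)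
open Computable

record AllComputable (fs : Vec ℕ n → Vec ℕ m) : Set where
  field
    codes      : Vec (Code n) m
    allCorrect : ∀ {O} xs → EvalAll O xs codes (fs xs)
open AllComputable

record Computable₁ (f : ℕ → ℕ) : Set where
  constructor computable₁
  field unary : Computable {1} (λ xs → f (lookup xs zero))
open Computable₁

record Computable₂ (f : ℕ → ℕ → ℕ) : Set where
  constructor computable₂
  field binary : Computable {2} (λ xs → f (lookup xs zero) (lookup xs (suc zero)))
open Computable₂

[]ᶜ : AllComputable {n} (λ _ → [])
[]ᶜ = record { codes = [] ; allCorrect = λ _ → ea-[] }

_∷ᶜ_ : {fs : Vec ℕ n → Vec ℕ m} →
       Computable f → AllComputable fs → AllComputable (λ xs → f xs ∷ fs xs)
F ∷ᶜ Fs = record { codes = code F ∷ codes Fs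
                 ; allCorrect = λ xs → ea-∷ (correct F xs) (allCorrect Fs xs) }
infixr 5 _∷ᶜ_

zeroᶜ : Computable {n} (λ _ → 0)
zeroᶜ = record { code = czero ; correct = λ _ → ev-zero }

sucᶜ : Computable₁ suc
sucᶜ = computable₁ (record { code = csucc ; correct = λ { (x ∷ []) → ev-succ } })

projᶜ : (i : Fin n) → Computable (λ xs → lookup xs i)
projᶜ i = record { code = cproj i ; correct = λ _ → ev-proj }

compose : {f : Vec ℕ m → ℕ} {gs : Vec ℕ n → Vec ℕ m} →
          Computable f → AllComputable gs → Computable (λ xs → f (gs xs))
compose F Gs = record { code = ccomp (code F) (codes Gs)
                      ; correct = λ xs → ev-comp (allCorrect Gs xs) (correct F _) }

recursion : {f : Vec ℕ (suc n) → ℕ} → Computable g → Computable h →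
            (∀ xs → f (0 ∷ xs) ≡ g xs) →
            (∀ k xs → f (suc k ∷ xs) ≡ h (k ∷ f (k ∷ xs) ∷ xs)) →
            Computable f
recursion {f = f} G H f-zero f-suc =
  record { code = cprec (code G) (code H) ; correct = λ { (k ∷ xs) → evaluates k xs } }
  where
    evaluates : ∀ {O} k xs → Eval O (cprec (code G) (code H)) (k ∷ xs) (f (k ∷ xs))
    evaluates zero    xs = subst (Eval _ _ _) (sym (f-zero xs)) (ev-prec0 (correct G xs))
    evaluates (suc k) xs = subst (Eval _ _ _) (sym (f-suc k xs))
                             (ev-precS (evaluates k xs) (correct H _))

_∘ᶜ_ : {f : ℕ → ℕ} → Computable₁ f → Computable g → Computable (λ xs → f (g xs))
F ∘ᶜ G = compose (unary F) (G ∷ᶜ []ᶜ)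
infixr 9 _∘ᶜ_

compose₂ : {f : ℕ → ℕ → ℕ} → Computable₂ f → Computable g → Computable h →
           Computable (λ xs → f (g xs) (h xs))
compose₂ F G H = compose (binary F) (G ∷ᶜ H ∷ᶜ []ᶜ)

predᶜ : Computable₁ pred
predᶜ = computable₁ (recursion zeroᶜ (projᶜ zero) (λ _ → refl) (λ _ _ → refl))

plusᶜ : Computable₂ _+_
plusᶜ = computable₂
  (recursion (projᶜ zero) (sucᶜ ∘ᶜ projᶜ (suc zero)) (λ _ → refl) (λ _ _ → refl))

monusᶜ : Computable₂ (flip _∸_)
monusᶜ = computable₂
  (recursion (projᶜ zero) (predᶜ ∘ᶜ projᶜ (suc zero)) (λ _ → refl)
             (λ k xs → sym (pred[m∸n]≡m∸[1+n] (lookup xs zero) k)))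

_+ᶜ_ : Computable g → Computable h → Computable (λ xs → g xs + h xs)
_+ᶜ_ = compose₂ plusᶜ
infixl 6 _+ᶜ_

_∸ᶜ_ : Computable g → Computable h → Computable (λ xs → g xs ∸ h xs)
G ∸ᶜ H = compose₂ monusᶜ H G
infixl 6 _∸ᶜ_

triangle : ℕ → ℕ
triangle zero    = 0
triangle (suc k) = suc k + triangle k

triangleᶜ : Computable₁ triangle
triangleᶜ = computable₁
  (recursion zeroᶜ (sucᶜ ∘ᶜ projᶜ zero +ᶜ projᶜ (suc zero)) (λ _ → refl) (λ _ _ → refl))

pair : ℕ → ℕ → ℕ
pair a b = triangle (a + b) + a

-- diagonal n is the d with triangle d ≤ n < triangle (suc d); the summand
-- 1 ∸ (m ∸ n) is the indicator of m ≤ n.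
diagonal : ℕ → ℕ
diagonal zero    = 0
diagonal (suc n) = diagonal n + (1 ∸ (triangle (suc (diagonal n)) ∸ suc n))

unpair₁ unpair₂ : ℕ → ℕ
unpair₁ n = n ∸ triangle (diagonal n)
unpair₂ n = diagonal n ∸ unpair₁ n

unpair-suc-zero : ∀ n {a} → unpair n ≡ (a , 0) → unpair (suc n) ≡ (0 , suc a)
unpair-suc-zero n eq rewrite eq = refl

unpair-suc-suc : ∀ n {a b} → unpair n ≡ (a , suc b) → unpair (suc n) ≡ (suc a , b)
unpair-suc-suc n eq rewrite eq = refl

pair-zero-suc : ∀ b → pair 0 (suc b) ≡ suc (pair b 0)
pair-zero-suc b = cong suc (begin
  b + triangle b + 0     ≡⟨ +-identityʳ _ ⟩
  b + triangle b         ≡⟨ +-comm b _ ⟩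
  triangle b + b         ≡⟨ cong (λ c → triangle c + b) (sym (+-identityʳ b)) ⟩
  triangle (b + 0) + b   ∎)

pair-suc : ∀ a b → pair (suc a) b ≡ suc (pair a (suc b))
pair-suc a b = begin
  triangle (suc a + b) + suc a     ≡⟨ +-suc _ a ⟩
  suc (triangle (suc (a + b)) + a) ≡⟨ cong (λ c → suc (triangle c + a)) (sym (+-suc a b)) ⟩
  suc (triangle (a + suc b) + a)   ∎

pair-unpair : ∀ n → uncurry pair (unpair n) ≡ n
pair-unpair zero = refl
pair-unpair (suc n) with unpair n | pair-unpair n
... | a , zero  | p = trans (pair-zero-suc a) (cong suc p)
... | a , suc b | p = trans (pair-suc a b) (cong suc p)

-- The diagonal index d = a + b makes the recursion structural.
unpair-pair-diagonal : ∀ d a b → a + b ≡ d → unpair (pair a b) ≡ (a , b)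
unpair-pair-diagonal zero    zero zero    _  = refl
unpair-pair-diagonal (suc d) zero (suc b) eq =
  subst (λ m → unpair m ≡ (0 , suc b)) (sym (pair-zero-suc b))
    (unpair-suc-zero (pair b 0)
      (unpair-pair-diagonal d b 0 (trans (+-identityʳ b) (cong pred eq))))
unpair-pair-diagonal d (suc a) b eq =
  subst (λ m → unpair m ≡ (suc a , b)) (sym (pair-suc a b))
    (unpair-suc-suc (pair a (suc b))
      (unpair-pair-diagonal d a (suc b) (trans (+-suc a b) eq)))

unpair-pair : ∀ a b → unpair (pair a b) ≡ (a , b)
unpair-pair a b = unpair-pair-diagonal (a + b) a b refl

triangle-suc-∸ : ∀ d a → triangle (suc d) ∸ suc (triangle d + a) ≡ d ∸ a
triangle-suc-∸ d a = begin
  d + triangle d ∸ (triangle d + a)  ≡⟨ cong (_∸ (triangle d + a)) (+-comm d _) ⟩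
  triangle d + d ∸ (triangle d + a)  ≡⟨ [m+n]∸[m+o]≡n∸o (triangle d) d a ⟩
  d ∸ a                              ∎

diagonal-suc : ∀ n a b → diagonal n ≡ a + b → pair a b ≡ n →
               diagonal (suc n) ≡ a + b + (1 ∸ b)
diagonal-suc n a b d≡a+b refl = begin
  diagonal n + (1 ∸ (triangle (suc (diagonal n)) ∸ suc n))
    ≡⟨ cong (λ d → d + (1 ∸ (triangle (suc d) ∸ suc n))) d≡a+b ⟩
  a + b + (1 ∸ (triangle (suc (a + b)) ∸ suc (triangle (a + b) + a)))
    ≡⟨ cong (λ m → a + b + (1 ∸ m)) (triangle-suc-∸ (a + b) a) ⟩
  a + b + (1 ∸ (a + b ∸ a))
    ≡⟨ cong (λ m → a + b + (1 ∸ m)) (m+n∸m≡n a b) ⟩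
  a + b + (1 ∸ b)
    ∎

diagonal-unpair : ∀ n → diagonal n ≡ uncurry _+_ (unpair n)
diagonal-unpair zero = refl
diagonal-unpair (suc n) with unpair n | pair-unpair n | diagonal-unpair n
... | a , zero  | p | d = begin
  diagonal (suc n) ≡⟨ diagonal-suc n a 0 d p ⟩
  a + 0 + 1        ≡⟨ +-comm (a + 0) 1 ⟩
  suc (a + 0)      ≡⟨ cong suc (+-identityʳ a) ⟩
  suc a            ∎
... | a , suc b | p | d = begin
  diagonal (suc n)        ≡⟨ diagonal-suc n a (suc b) d p ⟩
  a + suc b + (0 ∸ b)     ≡⟨ cong (a + suc b +_) (0∸n≡0 b) ⟩
  a + suc b + 0           ≡⟨ +-identityʳ _ ⟩
  a + suc b               ≡⟨ +-suc a b ⟩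
  suc (a + b)             ∎

unpair-components : ∀ n → unpair n ≡ (unpair₁ n , unpair₂ n)
unpair-components n with unpair n | pair-unpair n | diagonal-unpair n
... | a , b | refl | d≡a+b = sym (cong₂ _,_ unpair₁≡a unpair₂≡b)
  where
    unpair₁≡a : unpair₁ (pair a b) ≡ a
    unpair₁≡a = trans (cong (λ d → pair a b ∸ triangle d) d≡a+b)
                      (m+n∸m≡n (triangle (a + b)) a)
    unpair₂≡b : unpair₂ (pair a b) ≡ b
    unpair₂≡b = trans (cong₂ _∸_ d≡a+b unpair₁≡a) (m+n∸m≡n a b)

swapIndex : ℕ → ℕ
swapIndex n = pair (unpair₂ n) (unpair₁ n)

unpair-swapIndex : ∀ n → unpair (swapIndex n) ≡ (proj₂ (unpair n) , proj₁ (unpair n))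
unpair-swapIndex n = begin
  unpair (swapIndex n)                  ≡⟨ unpair-pair (unpair₂ n) (unpair₁ n) ⟩
  (unpair₂ n , unpair₁ n)               ≡⟨ cong (λ p → proj₂ p , proj₁ p) (sym (unpair-components n)) ⟩
  (proj₂ (unpair n) , proj₁ (unpair n)) ∎

swapIndexᶜ : Computable₁ swapIndex
swapIndexᶜ = computable₁ (compose₂ pairᶜ unpair₂ᶜ unpair₁ᶜ)
  where
    pairᶜ : Computable₂ pair
    pairᶜ = computable₂ (triangleᶜ ∘ᶜ (projᶜ zero +ᶜ projᶜ (suc zero)) +ᶜ projᶜ zero)
    diagonalᶜ : Computable₁ diagonal
    diagonalᶜ = computable₁ (recursion zeroᶜ
      (r +ᶜ (oneᶜ ∸ᶜ (triangleᶜ ∘ᶜ sucᶜ ∘ᶜ r ∸ᶜ sucᶜ ∘ᶜ k))) (λ _ → refl) (λ _ _ → refl))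
      where
        k : Computable {2} (λ xs → lookup xs zero)
        k = projᶜ zero
        r : Computable {2} (λ xs → lookup xs (suc zero))
        r = projᶜ (suc zero)
        oneᶜ : Computable {2} (λ _ → 1)
        oneᶜ = sucᶜ ∘ᶜ zeroᶜ
    unpair₁ᶜ : Computable (λ xs → unpair₁ (lookup xs zero))
    unpair₁ᶜ = projᶜ zero ∸ᶜ triangleᶜ ∘ᶜ unary diagonalᶜ
    unpair₂ᶜ : Computable (λ xs → unpair₂ (lookup xs zero))
    unpair₂ᶜ = unary diagonalᶜ ∸ᶜ unpair₁ᶜ

≤T-refl : ∀ A → A ≤T A
≤T-refl A = corac , λ _ → ev-orac

≤m⇒≤T : ∀ {A B f} → Computable₁ f → (∀ n → A n ≡ B (f n)) → A ≤T B
≤m⇒≤T (computable₁ F) A≡B∘f =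
  ccomp corac (code F ∷ []) ,
  λ n → ev-comp (ea-∷ (correct F (n ∷ [])) ea-[])
                (subst (λ b → Eval _ corac _ (b2n b)) (sym (A≡B∘f n)) ev-orac)

encRel-flip-≤T : ∀ le → encRel (flip le) ≤T encRel le
encRel-flip-≤T le = ≤m⇒≤T swapIndexᶜ λ n →
  sym (cong (λ p → le (proj₁ p) (proj₂ p)) (unpair-swapIndex n))

module _ {le : Rel} where

  flip-IsPoset : IsPoset le → IsPoset (flip le)
  flip-IsPoset (inP , antisym , transitive) =
    (λ x y le-yx → swap (inP y x le-yx)) ,
    (λ x y le-yx le-xy → antisym x y le-xy le-yx) ,
    (λ x y z le-yx le-zy → transitive z y x le-zy le-yx)

  flip-StableLarge : StableLarge le → StableSmall (flip le)
  flip-StableLarge stable x x∈P = Sum.map₂ isolated (stable x x∈P)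
    where
      isolated : Isolated le x → Isolated (flip le) x
      isolated (N , incomparable) = N , λ y N≤y y∈P → swap (incomparable y N≤y y∈P)

  flip-SCACSol : ∀ {Y} → SCACSol (flip le) Y → SCACSol le Y
  flip-SCACSol (Y⊆P , infinite , solution) = Y⊆P , infinite , Sum.map chain antichain solution
    where
      chain : ∀ {Y} → IsChain (flip le) Y → IsChain le Y
      chain c x y x∈Y y∈Y = Sum.swap (c x y x∈Y y∈Y)
      antichain : ∀ {Y} → IsAntichain (flip le) Y → IsAntichain le Y
      antichain a x y x∈Y y∈Y x≢y = swap (a x y x∈Y y∈Y x≢y)

SCAC≤scSCACsmall : SCAC ≤sc SCACsmall
SCAC≤scSCACsmall (le , poset , infinite , inj₁ small) =
  (le , poset , infinite , small) , ≤T-refl _ , λ Y sol → Y , sol , ≤T-refl Y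
SCAC≤scSCACsmall (le , poset , infinite , inj₂ large) =
  (flip le , flip-IsPoset poset , infinite , flip-StableLarge large) ,
  encRel-flip-≤T le , λ Y sol → Y , flip-SCACSol sol , ≤T-refl Y

SCACsmall≤scSCAC : SCACsmall ≤sc SCAC
SCACsmall≤scSCAC (le , poset , infinite , small) =
  (le , poset , infinite , inj₁ small) , ≤T-refl _ , λ Y sol → Y , sol , ≤T-refl Y

theorem7 : (SCAC ≤sc SCACsmall) × (SCACsmall ≤sc SCAC)
theorem7 = SCAC≤scSCACsmall , SCACsmall≤scSCAC
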